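{- For every positive integer $n$, $a_0(n)=a_2(n)$.
   Context: For a positive integer $n$, $T_n$ denotes the triangular lattice with $n$ rows: the set of points $\{a(1,0)+b(\tfrac12,\tfrac{\sqrt3}{2}) : a,b\in\mathbb{Z}_{\ge 0},\ a+b\le n-1\}$ in the plane. For an unordered pair $\{p_1,p_2\}$ of distinct points of $T_n$, the number of points $p_3\in T_n$ such that $p_1,p_2,p_3$ are the vertices of an equilateral triangle is $0$, $1$ or $2$. For $i\in\{0,1,2\}$, $a_i(n)$ denotes the number of unordered pairs of distinct points of $T_n$ for which this number equals $i$. -}

module Defs where

open import Data.Nat using (ℕ; _∸_)
open import Data.Nat.Properties using () renaming (_≟_ to _≟ℕ_)
open import Data.Integer as ℤ using (ℤ; +_)
open import Data.Integer.Properties using () renaming (_≟_ to _≟ℤ_)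
open import Data.Product using (_×_; _,_)
open import Data.Product.Properties using (≡-dec)
open import Data.List using (List; []; _∷_; map; concatMap; upTo; filter; length; _++_)
open import Relation.Nullary using (Dec; ¬_; _×-dec_; ¬?)
open import Relation.Binary.PropositionalEquality using (_≡_)

-- A point a·(1,0) + b·(1/2, √3/2) of the plane, recorded by its lattice
-- coordinates (a , b) ∈ ℕ × ℕ.  The map (a , b) ↦ a(1,0)+b(1/2,√3/2) is injective.
Point : Set
Point = ℕ × ℕ

_≟P_ : (p q : Point) → Dec (p ≡ q)
_≟P_ = ≡-dec _≟ℕ_ _≟ℕ_

T : ℕ → List Point
T n = concatMap (λ a → map (λ b → (a , b)) (upTo (n ∸ a))) (upTo n)

-- Exact squared Euclidean distance between the plane points represented by p and q:
-- |x(1,0) + y(1/2,√3/2)|² = x² + x y + y²  with (x , y) = p - q.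
dist² : Point → Point → ℤ
dist² (a₁ , b₁) (a₂ , b₂) =
  let x = (+ a₁) ℤ.- (+ a₂)
      y = (+ b₁) ℤ.- (+ b₂)
  in x ℤ.* x ℤ.+ x ℤ.* y ℤ.+ y ℤ.* y

Equilateral : Point → Point → Point → Set
Equilateral p q r =
  (¬ p ≡ q) × (¬ q ≡ r) × (¬ r ≡ p) × (dist² p q ≡ dist² q r) × (dist² q r ≡ dist² r p)

equilateral? : (p q r : Point) → Dec (Equilateral p q r)
equilateral? p q r =
  ¬? (p ≟P q) ×-dec ¬? (q ≟P r) ×-dec ¬? (r ≟P p)
    ×-dec (dist² p q ≟ℤ dist² q r) ×-dec (dist² q r ≟ℤ dist² r p)

thirdCount : ℕ → Point × Point → ℕ
thirdCount n (p₁ , p₂) = length (filter (λ p₃ → equilateral? p₁ p₂ p₃) (T n))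

pairs : {A : Set} → List A → List (A × A)
pairs [] = []
pairs (x ∷ xs) = map (λ y → (x , y)) xs ++ pairs xs

a : ℕ → ℕ → ℕ
a i n = length (filter (λ pq → thirdCount n pq ≟ℕ i) (pairs (T n)))

module Submission where

open import Defs
open import Data.Nat using (ℕ; _≤_)
open import Relation.Binary.PropositionalEquality using (_≡_)

-- For p ≠ q the equilateral triangles with vertices p, q are those whose third vertex is
-- the apex p + ρ (q - p) or the apex q + ρ (p - q), ρ being the rotation by 60°.  Hence
-- a₁ + 2 a₂ = ∑ thirdCount counts the ordered pairs (p , q) of distinct points of Tₙ whose
-- apex p + ρ (q - p) lies in Tₙ.  For fixed p = (a , b), the q ∈ Tₙ whose apex falls
-- outside Tₙ fill three disjoint corner triangles of Tₙ, with a, b and n - 1 - a - b rows;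
-- summing over p shows that exactly N (N - 1) / 2 ordered pairs of distinct points have
-- their apex in Tₙ, where N = |Tₙ|.  As a₀ + a₁ + a₂ = N (N - 1) / 2 as well, a₀ = a₂.

open import Data.Bool using (true; false; if_then_else_)
open import Data.Empty using (⊥)
open import Data.List
  using (List; []; _∷_; _++_; [_]; map; concatMap; upTo; applyUpTo; filter; length)
open import Data.List.Properties
  using (map-++; map-∘; map-cong; map-cong-local; map-upTo; upTo-∷ʳ; length-upTo;
         concatMap-map; concatMap-cong; map-concatMap)
open import Data.List.Membership.Propositional.Properties using (∈-upTo⁻)
import Data.List.Relation.Unary.All as All
open import Data.Nat.ListAction using (sum)
open import Data.Nat.ListAction.Properties using (sum-++)
open import Data.Product using (_×_; _,_; proj₁; proj₂; uncurry; map₁)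
open import Data.Sum using (_⊎_; inj₁; inj₂; [_,_]′) renaming (map to map-⊎)
open import Function using (_∘_; _⇔_; mk⇔; Equivalence)
open import Relation.Nullary using (Dec; yes; no; does; ¬_; ¬?; _×-dec_; contradiction)
open import Relation.Binary.PropositionalEquality
  using (refl; sym; trans; cong; cong₂; subst; module ≡-Reasoning)

open Equivalence using (to; from)

module Plane where

  open import Data.Integer using (ℤ; +_; -[1+_]; 0ℤ; _+_; _-_; _*_; ∣_∣)
  open import Data.Integer.Properties
    using (pos-*; pos-+; +-injective; ∣i∣≡0⇒i≡0; i*j≡0⇒i≡0∨j≡0; i-j≡0⇒i≡j;
           +-inverseʳ; *-cancelˡ-≡)
  open import Data.Integer.Tactic.RingSolver using (solve-∀)
  import Data.Nat as ℕ
  import Data.Nat.Properties as ℕ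

  ℤ² : Set
  ℤ² = ℤ × ℤ

  -- |x·(1,0) + y·(1/2,√3/2)|²
  norm : ℤ → ℤ → ℤ
  norm x y = x * x + x * y + y * y

  d² : ℤ² → ℤ² → ℤ
  d² (a , b) (c , d) = norm (a - c) (b - d)

  -- apex P Q = P + ρ (Q - P), where ρ (x , y) = (- y , x + y) is the rotation by 60°.
  apex : ℤ² → ℤ² → ℤ²
  apex (a , b) (c , d) = (a + b - d , c + d - a)

  EqualSides : ℤ² → ℤ² → ℤ² → Set
  EqualSides P Q R = d² P Q ≡ d² Q R × d² Q R ≡ d² R P

  square≡∣∣² : ∀ i → i * i ≡ + (∣ i ∣ ℕ.* ∣ i ∣)
  square≡∣∣² (+ m)    = sym (pos-* m m)
  square≡∣∣² -[1+ m ] = refl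

  norm≡0⇒y≡0 : ∀ x y → norm x y ≡ 0ℤ → y ≡ 0ℤ
  norm≡0⇒y≡0 x y N≡0 =
    ∣i∣≡0⇒i≡0 (square≡0 (three*≡0 (ℕ.m+n≡0⇒n≡0 (∣ s ∣ ℕ.* ∣ s ∣) (+-injective sum≡0))))
    where
    open ≡-Reasoning
    s = x + x + y
    four-norm : ∀ x y →
      + 4 * (x * x + x * y + y * y) ≡ (x + x + y) * (x + x + y) + + 3 * (y * y)
    four-norm = solve-∀
    sum≡0 : + (∣ s ∣ ℕ.* ∣ s ∣ ℕ.+ 3 ℕ.* (∣ y ∣ ℕ.* ∣ y ∣)) ≡ 0ℤ
    sum≡0 = begin
      + (∣ s ∣ ℕ.* ∣ s ∣ ℕ.+ 3 ℕ.* (∣ y ∣ ℕ.* ∣ y ∣))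
        ≡⟨ pos-+ (∣ s ∣ ℕ.* ∣ s ∣) (3 ℕ.* (∣ y ∣ ℕ.* ∣ y ∣)) ⟩
      + (∣ s ∣ ℕ.* ∣ s ∣) + + (3 ℕ.* (∣ y ∣ ℕ.* ∣ y ∣))
        ≡⟨ cong₂ _+_ (sym (square≡∣∣² s))
                     (trans (pos-* 3 (∣ y ∣ ℕ.* ∣ y ∣)) (cong (+ 3 *_) (sym (square≡∣∣² y)))) ⟩
      s * s + + 3 * (y * y)
        ≡⟨ sym (four-norm x y) ⟩
      + 4 * norm x y
        ≡⟨ cong (+ 4 *_) N≡0 ⟩
      0ℤ ∎
    three*≡0 : ∀ {m} → 3 ℕ.* m ≡ 0 → m ≡ 0
    three*≡0 eq = [ (λ ()) , (λ m≡0 → m≡0) ]′ (ℕ.m*n≡0⇒m≡0∨n≡0 3 eq)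
    square≡0 : ∀ {m} → m ℕ.* m ≡ 0 → m ≡ 0
    square≡0 {m} eq = [ (λ m≡0 → m≡0) , (λ m≡0 → m≡0) ]′ (ℕ.m*n≡0⇒m≡0∨n≡0 m eq)

  norm-comm : ∀ x y → norm x y ≡ norm y x
  norm-comm = identity
    where
    identity : ∀ x y → let n x y = x * x + x * y + y * y in n x y ≡ n y x
    identity = solve-∀

  norm≡0⇒≡0 : ∀ x y → norm x y ≡ 0ℤ → x ≡ 0ℤ × y ≡ 0ℤ
  norm≡0⇒≡0 x y N≡0 = norm≡0⇒y≡0 y x (trans (norm-comm y x) N≡0) , norm≡0⇒y≡0 x y N≡0

  d²≡0⇒≡ : ∀ P Q → d² P Q ≡ 0ℤ → P ≡ Q
  d²≡0⇒≡ (a , b) (c , d) D≡0 with norm≡0⇒≡0 (a - c) (b - d) D≡0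
  ... | a-c≡0 , b-d≡0 = cong₂ _,_ (i-j≡0⇒i≡j a c a-c≡0) (i-j≡0⇒i≡j b d b-d≡0)

  d²-refl : ∀ P → d² P P ≡ 0ℤ
  d²-refl (a , b) = cong₂ norm (+-inverseʳ a) (+-inverseʳ b)

  d²-sym : ∀ P Q → d² P Q ≡ d² Q P
  d²-sym (a , b) (c , d) = identity a b c d
    where
    identity : ∀ a b c d → let n x y = x * x + x * y + y * y in
      n (a - c) (b - d) ≡ n (c - a) (d - b)
    identity = solve-∀

  EqualSides-swap : ∀ P Q R → EqualSides Q P R → EqualSides P Q R
  EqualSides-swap P Q R (qp≡pr , pr≡rq) =
    trans (d²-sym P Q) (trans qp≡pr (trans pr≡rq (d²-sym R Q))) ,
    trans (d²-sym Q R) (trans (sym pr≡rq) (d²-sym P R))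

  apex-equal-sides : ∀ P Q → EqualSides P Q (apex P Q)
  apex-equal-sides (a , b) (c , d) = identity₁ a b c d , identity₂ a b c d
    where
    identity₁ : ∀ a b c d → let n x y = x * x + x * y + y * y in
      n (a - c) (b - d) ≡ n (c - (a + b - d)) (d - (c + d - a))
    identity₁ = solve-∀
    identity₂ : ∀ a b c d → let n x y = x * x + x * y + y * y in
      n (c - (a + b - d)) (d - (c + d - a)) ≡ n (a + b - d - a) (c + d - a - b)
    identity₂ = solve-∀

  d²-apexes : ∀ P Q → d² (apex P Q) (apex Q P) ≡ + 3 * d² P Q
  d²-apexes (a , b) (c , d) = identity a b c d
    where
    identity : ∀ a b c d → let n x y = x * x + x * y + y * y in
      n (a + b - d - (c + d - b)) (c + d - a - (a + b - c)) ≡ + 3 * n (a - c) (b - d)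
    identity = solve-∀

  -- For squared sides x, y, z the right-hand side is ((x - y)² + (y - z)² + (z - x)²) / 2,
  -- so it vanishes exactly when the triangle P Q R is equilateral.
  d²-apex-product : ∀ P Q R → let x = d² P Q ; y = d² Q R ; z = d² R P in
    d² R (apex P Q) * d² R (apex Q P) ≡ x * x + y * y + z * z - x * y - y * z - z * x
  d²-apex-product (a , b) (c , d) (e , f) = identity a b c d e f
    where
    identity : ∀ a b c d e f →
      let n x y = x * x + x * y + y * y
          x = n (a - c) (b - d) ; y = n (c - e) (d - f) ; z = n (e - a) (f - b)
      in n (e - (a + b - d)) (f - (c + d - a)) * n (e - (c + d - b)) (f - (a + b - c))
           ≡ x * x + y * y + z * z - x * y - y * z - z * x
    identity = solve-∀

  equal-sides⇒apex : ∀ P Q R → EqualSides P Q R → R ≡ apex P Q ⊎ R ≡ apex Q P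
  equal-sides⇒apex P Q R (x≡y , y≡z) =
    map-⊎ (d²≡0⇒≡ R (apex P Q)) (d²≡0⇒≡ R (apex Q P))
          (i*j≡0⇒i≡0∨j≡0 (d² R (apex P Q)) product≡0)
    where
    open ≡-Reasoning
    x = d² P Q
    y = d² Q R
    z = d² R P
    equal-squares : ∀ x → x * x + x * x + x * x - x * x - x * x - x * x ≡ + 0
    equal-squares = solve-∀
    product≡0 : d² R (apex P Q) * d² R (apex Q P) ≡ 0ℤ
    product≡0 = begin
      d² R (apex P Q) * d² R (apex Q P)
        ≡⟨ d²-apex-product P Q R ⟩
      x * x + y * y + z * z - x * y - y * z - z * x
        ≡⟨ cong₂ (λ y z → x * x + y * y + z * z - x * y - y * z - z * x)
                 (sym x≡y) (sym (trans x≡y y≡z)) ⟩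
      x * x + x * x + x * x - x * x - x * x - x * x
        ≡⟨ equal-squares x ⟩
      0ℤ ∎

  apex-comm⇒≡ : ∀ P Q → apex P Q ≡ apex Q P → P ≡ Q
  apex-comm⇒≡ P Q same-apex = d²≡0⇒≡ P Q (*-cancelˡ-≡ (+ 3) (d² P Q) 0ℤ (begin
    + 3 * d² P Q              ≡⟨ sym (d²-apexes P Q) ⟩
    d² (apex P Q) (apex Q P)  ≡⟨ cong (d² (apex P Q)) (sym same-apex) ⟩
    d² (apex P Q) (apex P Q)  ≡⟨ d²-refl (apex P Q) ⟩
    0ℤ                        ∎))
    where open ≡-Reasoning

  ι : Point → ℤ²
  ι (a , b) = (+ a , + b)

  ι-injective : ∀ {p q} → ι p ≡ ι q → p ≡ q
  ι-injective eq = cong₂ _,_ (+-injective (cong proj₁ eq)) (+-injective (cong proj₂ eq))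

  m≡k+l-n⇔m+n≡k+l : ∀ m n k l → (+ m ≡ + k + + l - + n) ⇔ (m ℕ.+ n ≡ k ℕ.+ l)
  m≡k+l-n⇔m+n≡k+l m n k l = mk⇔ to′ from′
    where
    open ≡-Reasoning
    i-j+j≡i : ∀ i j → i - j + j ≡ i
    i-j+j≡i = solve-∀
    i+j-j≡i : ∀ i j → i + j - j ≡ i
    i+j-j≡i = solve-∀
    to′ : + m ≡ + k + + l - + n → m ℕ.+ n ≡ k ℕ.+ l
    to′ eq = +-injective (begin
      + (m ℕ.+ n)           ≡⟨ pos-+ m n ⟩
      + m + + n             ≡⟨ cong (_+ + n) eq ⟩
      + k + + l - + n + + n ≡⟨ i-j+j≡i (+ k + + l) (+ n) ⟩
      + k + + l             ≡⟨ sym (pos-+ k l) ⟩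
      + (k ℕ.+ l)           ∎)
    from′ : m ℕ.+ n ≡ k ℕ.+ l → + m ≡ + k + + l - + n
    from′ eq = begin
      + m                   ≡⟨ sym (i+j-j≡i (+ m) (+ n)) ⟩
      + m + + n - + n       ≡⟨ cong (_- + n) (sym (pos-+ m n)) ⟩
      + (m ℕ.+ n) - + n     ≡⟨ cong (λ s → + s - + n) eq ⟩
      + (k ℕ.+ l) - + n     ≡⟨ cong (_- + n) (pos-+ k l) ⟩
      + k + + l - + n       ∎

  ≢⇒dist²≢0 : ∀ {p q} → ¬ p ≡ q → ¬ dist² p q ≡ 0ℤ
  ≢⇒dist²≢0 {p} {q} p≢q pq≡0 = p≢q (ι-injective (d²≡0⇒≡ (ι p) (ι q) pq≡0))

  dist²-refl : ∀ p → dist² p p ≡ 0ℤ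
  dist²-refl p = d²-refl (ι p)

open Plane

open import Data.Nat
  using (zero; suc; _+_; _*_; _∸_; _⊓_; _<_; z≤n; s≤s; s≤s⁻¹; _≟_; _≤?_; _<?_)
open import Data.Nat.Properties
  using (+-identityʳ; *-zeroʳ; +-comm; +-assoc; *-identityˡ; *-suc; *-assoc;
         *-distribˡ-+; *-distribʳ-+; +-cancelˡ-≡; +-cancelʳ-≡; *-cancelˡ-≡;
         ≤-trans; <-trans; ≤-<-trans; <⇒≤; m≤m+n; m≤n+m; +-monoʳ-≤; +-monoˡ-<; +-monoʳ-<;
         +-mono-≤; *-mono-≤; ≰⇒>; <⇒≱; ≮⇒≥; ≤⇒≯; m+n∸n≡m; m∸n+n≡m; m≤n+o⇒m∸n≤o; m≤n+m∸n;
         m∸[m∸n]≡n; m≥n⇒m⊓n≡n; 0∸n≡0; +-commutativeSemigroup)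
open import Algebra.Properties.CommutativeSemigroup +-commutativeSemigroup using (interchange)
open import Data.Nat.Tactic.RingSolver using (solve-∀; solve)

private variable
  A B : Set

-- Indicators and finite sums

𝟙 : ∀ {P : Set} → Dec P → ℕ
𝟙 P? = if does P? then 1 else 0

𝟙-yes : ∀ {P} (P? : Dec P) → P → 𝟙 P? ≡ 1
𝟙-yes (yes _) _ = refl
𝟙-yes (no ¬p) p = contradiction p ¬p

𝟙-no : ∀ {P} (P? : Dec P) → ¬ P → 𝟙 P? ≡ 0
𝟙-no (yes p) ¬p = contradiction p ¬p
𝟙-no (no _)  _  = refl

𝟙-cong : ∀ {P Q} (P? : Dec P) (Q? : Dec Q) → P ⇔ Q → 𝟙 P? ≡ 𝟙 Q?
𝟙-cong (yes p) Q? P⇔Q = sym (𝟙-yes Q? (to P⇔Q p))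
𝟙-cong (no ¬p) Q? P⇔Q = sym (𝟙-no Q? (¬p ∘ from P⇔Q))

𝟙≤1 : ∀ {P} (P? : Dec P) → 𝟙 P? ≤ 1
𝟙≤1 (yes _) = s≤s z≤n
𝟙≤1 (no _)  = z≤n

𝟙-× : ∀ {P Q} (P? : Dec P) (Q? : Dec Q) → 𝟙 (P? ×-dec Q?) ≡ 𝟙 P? * 𝟙 Q?
𝟙-× (yes _) (yes _) = refl
𝟙-× (yes _) (no _)  = refl
𝟙-× (no _)  _       = refl

𝟙-¬ : ∀ {P} (P? : Dec P) → 𝟙 (¬? P?) + 𝟙 P? ≡ 1
𝟙-¬ (yes _) = refl
𝟙-¬ (no _)  = refl

𝟙-⊎ : ∀ {P Q R} (R? : Dec R) (P? : Dec P) (Q? : Dec Q) →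
      (P → Q → ⊥) → R ⇔ (P ⊎ Q) → 𝟙 R? ≡ 𝟙 P? + 𝟙 Q?
𝟙-⊎ R? (yes p) (yes q) P→¬Q _     = contradiction q (P→¬Q p)
𝟙-⊎ R? (yes p) (no _)  _    R⇔P⊎Q = 𝟙-yes R? (from R⇔P⊎Q (inj₁ p))
𝟙-⊎ R? (no _)  (yes q) _    R⇔P⊎Q = 𝟙-yes R? (from R⇔P⊎Q (inj₂ q))
𝟙-⊎ R? (no ¬p) (no ¬q) _    R⇔P⊎Q = 𝟙-no R? ([ ¬p , ¬q ]′ ∘ to R⇔P⊎Q)

𝟙-partition : ∀ {P Q R} (P? : Dec P) (Q? : Dec Q) (R? : Dec R) → (¬ P → Q × R) → (¬ Q → R) →
              𝟙 (P? ×-dec Q? ×-dec R?) + 𝟙 (¬? P?) + 𝟙 (¬? Q?) + 𝟙 (¬? R?) ≡ 1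
𝟙-partition (yes _) (yes _) (yes _) _ _    = refl
𝟙-partition (yes _) (yes _) (no _)  _ _    = refl
𝟙-partition (yes _) (no _)  (yes _) _ _    = refl
𝟙-partition (yes _) (no ¬q) (no ¬r) _ ¬q⇒r = contradiction (¬q⇒r ¬q) ¬r
𝟙-partition (no ¬p) Q? R? ¬p⇒q×r _ =
  cong₂ (λ u v → 1 + u + v) (𝟙-no (¬? Q?) (λ ¬q → ¬q (proj₁ (¬p⇒q×r ¬p))))
                            (𝟙-no (¬? R?) (λ ¬r → ¬r (proj₂ (¬p⇒q×r ¬p))))

𝟙-≰ : ∀ m n → 𝟙 (¬? (m ≤? n)) ≡ 𝟙 (n <? m)
𝟙-≰ m n = 𝟙-cong (¬? (m ≤? n)) (n <? m) (mk⇔ ≰⇒> <⇒≱)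

𝟙-≮ : ∀ m n → 𝟙 (¬? (m <? n)) ≡ 𝟙 (n ≤? m)
𝟙-≮ m n = 𝟙-cong (¬? (m <? n)) (n ≤? m) (mk⇔ ≮⇒≥ ≤⇒≯)

∑ : List A → (A → ℕ) → ℕ
∑ xs f = sum (map f xs)

syntax ∑ xs (λ x → e) = ∑[ x ∈ xs ] e

∑-++ : ∀ (xs ys : List A) f → ∑ (xs ++ ys) f ≡ ∑ xs f + ∑ ys f
∑-++ xs ys f = trans (cong sum (map-++ f xs ys)) (sum-++ (map f xs) (map f ys))

∑-map : ∀ (g : A → B) xs f → ∑ (map g xs) f ≡ ∑ xs (f ∘ g)
∑-map g xs f = cong sum (sym (map-∘ xs))

∑-cong : ∀ {f g : A → ℕ} → (∀ x → f x ≡ g x) → ∀ xs → ∑ xs f ≡ ∑ xs g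
∑-cong f≗g xs = cong sum (map-cong f≗g xs)

∑-+ : ∀ (f g : A → ℕ) xs → ∑[ x ∈ xs ] (f x + g x) ≡ ∑ xs f + ∑ xs g
∑-+ f g []       = refl
∑-+ f g (x ∷ xs) =
  trans (cong (f x + g x +_) (∑-+ f g xs)) (interchange (f x) (g x) (∑ xs f) (∑ xs g))

∑-*ˡ : ∀ k (f : A → ℕ) xs → ∑[ x ∈ xs ] (k * f x) ≡ k * ∑ xs f
∑-*ˡ k f []       = sym (*-zeroʳ k)
∑-*ˡ k f (x ∷ xs) =
  trans (cong (k * f x +_) (∑-*ˡ k f xs)) (sym (*-distribˡ-+ k (f x) (∑ xs f)))

∑-const : ∀ k (xs : List A) → ∑[ _ ∈ xs ] k ≡ k * length xs
∑-const k []       = sym (*-zeroʳ k)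
∑-const k (x ∷ xs) = trans (cong (k +_) (∑-const k xs)) (sym (*-suc k (length xs)))

∑-one : ∀ (xs : List A) → ∑[ _ ∈ xs ] 1 ≡ length xs
∑-one xs = trans (∑-const 1 xs) (*-identityˡ (length xs))

length-filter : ∀ {P : A → Set} (P? : ∀ x → Dec (P x)) xs →
                length (filter P? xs) ≡ ∑[ x ∈ xs ] 𝟙 (P? x)
length-filter P? []       = refl
length-filter P? (x ∷ xs) with does (P? x)
... | true  = cong suc (length-filter P? xs)
... | false = length-filter P? xs

#zeros≡#twos : ∀ (f : A → ℕ) xs → (∀ x → f x ≤ 2) → ∑ xs f ≡ length xs →
               length (filter (λ x → f x ≟ 0) xs) ≡ length (filter (λ x → f x ≟ 2) xs)
#zeros≡#twos f xs f≤2 ∑f≡length = +-cancelˡ-≡ (∑ xs f) _ _ (begin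
  ∑ xs f + length (filter (λ x → f x ≟ 0) xs)
    ≡⟨ cong (∑ xs f +_) (length-filter (λ x → f x ≟ 0) xs) ⟩
  ∑ xs f + ∑[ x ∈ xs ] 𝟙 (f x ≟ 0)
    ≡⟨ sym (∑-+ f (λ x → 𝟙 (f x ≟ 0)) xs) ⟩
  ∑[ x ∈ xs ] (f x + 𝟙 (f x ≟ 0))
    ≡⟨ ∑-cong (λ x → balance (f x) (f≤2 x)) xs ⟩
  ∑[ x ∈ xs ] (1 + 𝟙 (f x ≟ 2))
    ≡⟨ ∑-+ (λ _ → 1) (λ x → 𝟙 (f x ≟ 2)) xs ⟩
  ∑[ _ ∈ xs ] 1 + ∑[ x ∈ xs ] 𝟙 (f x ≟ 2)
    ≡⟨ cong₂ _+_ (trans (∑-one xs) (sym ∑f≡length))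
                 (sym (length-filter (λ x → f x ≟ 2) xs)) ⟩
  ∑ xs f + length (filter (λ x → f x ≟ 2) xs) ∎)
  where
  open ≡-Reasoning
  balance : ∀ v → v ≤ 2 → v + 𝟙 (v ≟ 0) ≡ 1 + 𝟙 (v ≟ 2)
  balance 0 _ = refl
  balance 1 _ = refl
  balance 2 _ = refl
  balance (suc (suc (suc _))) (s≤s (s≤s ()))

∑-pairs : ∀ (G : A → A → ℕ) xs →
          ∑ (pairs xs) (λ (x , y) → G x y + G y x) + ∑[ x ∈ xs ] G x x
            ≡ ∑[ x ∈ xs ] ∑[ y ∈ xs ] G x y
∑-pairs G []       = refl
∑-pairs {A} G (x ∷ xs) = begin
  ∑ (map (x ,_) xs ++ pairs xs) φ + (G x x + D)
    ≡⟨ cong (_+ (G x x + D))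
            (trans (∑-++ (map (x ,_) xs) (pairs xs) φ)
                   (cong (_+ ∑ (pairs xs) φ)
                         (trans (∑-map (x ,_) xs φ) (∑-+ (G x) (λ y → G y x) xs)))) ⟩
  ∑ xs (G x) + ∑[ y ∈ xs ] G y x + ∑ (pairs xs) φ + (G x x + D)
    ≡⟨ shuffle (∑ xs (G x)) (∑[ y ∈ xs ] G y x) (∑ (pairs xs) φ) (G x x) D ⟩
  G x x + ∑ xs (G x) + (∑[ y ∈ xs ] G y x + (∑ (pairs xs) φ + D))
    ≡⟨ cong (λ s → G x x + ∑ xs (G x) + (∑[ y ∈ xs ] G y x + s)) (∑-pairs G xs) ⟩
  G x x + ∑ xs (G x) + (∑[ y ∈ xs ] G y x + ∑[ y ∈ xs ] ∑[ z ∈ xs ] G y z)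
    ≡⟨ cong (G x x + ∑ xs (G x) +_) (sym (∑-+ (λ y → G y x) (λ y → ∑ xs (G y)) xs)) ⟩
  G x x + ∑ xs (G x) + ∑[ y ∈ xs ] (G y x + ∑[ z ∈ xs ] G y z) ∎
  where
  open ≡-Reasoning
  φ : A × A → ℕ
  φ (x , y) = G x y + G y x
  D = ∑[ y ∈ xs ] G y y
  shuffle : ∀ r c p g d → r + c + p + (g + d) ≡ g + r + (c + (p + d))
  shuffle = solve-∀

length-pairs : ∀ (xs : List A) → 2 * length (pairs xs) + length xs ≡ length xs * length xs
length-pairs xs = begin
  2 * length (pairs xs) + length xs
    ≡⟨ sym (cong₂ _+_ (∑-const 2 (pairs xs)) (∑-one xs)) ⟩
  ∑[ _ ∈ pairs xs ] 2 + ∑[ _ ∈ xs ] 1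
    ≡⟨ ∑-pairs (λ _ _ → 1) xs ⟩
  ∑[ _ ∈ xs ] ∑[ _ ∈ xs ] 1
    ≡⟨ trans (∑-cong (λ _ → ∑-one xs) xs) (∑-const (length xs) xs) ⟩
  length xs * length xs ∎
  where open ≡-Reasoning

∑-upTo-suc : ∀ m (f : ℕ → ℕ) → ∑ (upTo (suc m)) f ≡ f 0 + ∑ (upTo m) (f ∘ suc)
∑-upTo-suc m f =
  cong (f 0 +_) (trans (cong (λ xs → ∑ xs f) (sym (map-upTo suc m))) (∑-map suc (upTo m) f))

∑-upTo-∷ʳ : ∀ m (f : ℕ → ℕ) → ∑ (upTo (suc m)) f ≡ ∑ (upTo m) f + f m
∑-upTo-∷ʳ m f = begin
  ∑ (upTo (suc m)) f         ≡⟨ cong (λ xs → ∑ xs f) (sym (upTo-∷ʳ m)) ⟩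
  ∑ (upTo m ++ [ m ]) f      ≡⟨ ∑-++ (upTo m) [ m ] f ⟩
  ∑ (upTo m) f + (f m + 0)   ≡⟨ cong (∑ (upTo m) f +_) (+-identityʳ (f m)) ⟩
  ∑ (upTo m) f + f m         ∎
  where open ≡-Reasoning

∑-upTo-cong : ∀ {m} {f g : ℕ → ℕ} → (∀ i → i < m → f i ≡ g i) → ∑ (upTo m) f ≡ ∑ (upTo m) g
∑-upTo-cong f≗g = cong sum (map-cong-local (All.tabulate (λ i∈ → f≗g _ (∈-upTo⁻ i∈))))

∑-upTo-≟ : ∀ m k → ∑[ i ∈ upTo m ] 𝟙 (i ≟ k) ≡ 𝟙 (k <? m)
∑-upTo-≟ zero    k       = refl
∑-upTo-≟ (suc m) zero    =
  trans (∑-upTo-suc m (λ i → 𝟙 (i ≟ 0))) (cong suc (∑-const 0 (upTo m)))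
∑-upTo-≟ (suc m) (suc k) = trans (∑-upTo-suc m (λ i → 𝟙 (i ≟ suc k))) (∑-upTo-≟ m k)

∑-upTo-< : ∀ m k → ∑[ i ∈ upTo m ] 𝟙 (i <? k) ≡ m ⊓ k
∑-upTo-< zero    k       = refl
∑-upTo-< (suc m) zero    = trans (∑-upTo-suc m (λ i → 𝟙 (i <? 0))) (∑-const 0 (upTo m))
∑-upTo-< (suc m) (suc k) =
  trans (∑-upTo-suc m (λ i → 𝟙 (i <? suc k))) (cong suc (∑-upTo-< m k))

∑-upTo-> : ∀ m k → ∑[ i ∈ upTo m ] 𝟙 (k <? i) ≡ m ∸ suc k
∑-upTo-> zero    k       = refl
∑-upTo-> (suc m) zero    =
  trans (∑-upTo-suc m (λ i → 𝟙 (0 <? i))) (trans (∑-one (upTo m)) (length-upTo m))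
∑-upTo-> (suc m) (suc k) = trans (∑-upTo-suc m (λ i → 𝟙 (suc k <? i))) (∑-upTo-> m k)

-- Equilateral triangles of the lattice

-- r = p + ρ (q - p), written without subtraction.
IsApex : Point → Point → Point → Set
IsApex (a , b) (c , d) (e , f) = e + d ≡ a + b × f + a ≡ c + d

isApex? : ∀ p q r → Dec (IsApex p q r)
isApex? (a , b) (c , d) (e , f) = (e + d ≟ a + b) ×-dec (f + a ≟ c + d)

IsApex⇔ : ∀ p q r → IsApex p q r ⇔ (ι r ≡ apex (ι p) (ι q))
IsApex⇔ (a , b) (c , d) (e , f) = mk⇔
  (λ (e+d≡a+b , f+a≡c+d) → cong₂ _,_ (from (m≡k+l-n⇔m+n≡k+l e d a b) e+d≡a+b)
                                      (from (m≡k+l-n⇔m+n≡k+l f a c d) f+a≡c+d))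
  (λ r≡apex → to (m≡k+l-n⇔m+n≡k+l e d a b) (cong proj₁ r≡apex) ,
              to (m≡k+l-n⇔m+n≡k+l f a c d) (cong proj₂ r≡apex))

equal-sides⇒equilateral : ∀ {p q r} → ¬ p ≡ q → EqualSides (ι p) (ι q) (ι r) →
                          Equilateral p q r
equal-sides⇒equilateral {p} {q} {r} p≢q (pq≡qr , qr≡rp) = p≢q , q≢r , r≢p , pq≡qr , qr≡rp
  where
  q≢r : ¬ q ≡ r
  q≢r refl = ≢⇒dist²≢0 p≢q (trans pq≡qr (dist²-refl q))
  r≢p : ¬ r ≡ p
  r≢p refl = ≢⇒dist²≢0 p≢q (trans pq≡qr (trans qr≡rp (dist²-refl r)))

equilateral⇔apex : ∀ {p q r} → ¬ p ≡ q → Equilateral p q r ⇔ (IsApex p q r ⊎ IsApex q p r)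
equilateral⇔apex {p} {q} {r} p≢q = mk⇔
  (λ (_ , _ , _ , sides) → map-⊎ (from (IsApex⇔ p q r)) (from (IsApex⇔ q p r))
                                  (equal-sides⇒apex (ι p) (ι q) (ι r) sides))
  [ (λ pqr → equal-sides⇒equilateral p≢q
       (subst (EqualSides (ι p) (ι q)) (sym (to (IsApex⇔ p q r) pqr))
              (apex-equal-sides (ι p) (ι q))))
  , (λ qpr → equal-sides⇒equilateral p≢q (EqualSides-swap (ι p) (ι q) (ι r)
       (subst (EqualSides (ι q) (ι p)) (sym (to (IsApex⇔ q p r) qpr))
              (apex-equal-sides (ι q) (ι p)))))
  ]′

IsApex-both⇒≡ : ∀ {p q r} → IsApex p q r → IsApex q p r → p ≡ q
IsApex-both⇒≡ {p} {q} {r} pqr qpr =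
  ι-injective (apex-comm⇒≡ (ι p) (ι q) (trans (sym (to (IsApex⇔ p q r) pqr))
                                               (to (IsApex⇔ q p r) qpr)))

-- Sums over the triangle

tri : ℕ → ℕ
tri zero    = 0
tri (suc n) = suc n + tri n

tet : ℕ → ℕ
tet zero    = 0
tet (suc n) = tri (suc n) + tet n

∑T : ℕ → (ℕ → ℕ → ℕ) → ℕ
∑T n f = ∑ (T n) (uncurry f)

T-suc : ∀ n → T (suc n) ≡ map (0 ,_) (upTo (suc n)) ++ map (map₁ suc) (T n)
T-suc n = cong (map (0 ,_) (upTo (suc n)) ++_) (begin
  concatMap column (applyUpTo suc n)
    ≡⟨ cong (concatMap column) (sym (map-upTo suc n)) ⟩
  concatMap column (map suc (upTo n))
    ≡⟨ concatMap-map column suc (upTo n) ⟩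
  concatMap (column ∘ suc) (upTo n)
    ≡⟨ concatMap-cong (λ a → map-∘ (upTo (n ∸ a))) (upTo n) ⟩
  concatMap (map (map₁ suc) ∘ column′) (upTo n)
    ≡⟨ sym (map-concatMap (map₁ suc) column′ (upTo n)) ⟩
  map (map₁ suc) (T n) ∎)
  where
  open ≡-Reasoning
  column column′ : ℕ → List Point
  column  a = map (a ,_) (upTo (suc n ∸ a))
  column′ a = map (a ,_) (upTo (n ∸ a))

∑T-suc : ∀ n f → ∑T (suc n) f ≡ ∑[ b ∈ upTo (suc n) ] f 0 b + ∑T n (f ∘ suc)
∑T-suc n f = begin
  ∑ (T (suc n)) (uncurry f)
    ≡⟨ cong (λ xs → ∑ xs (uncurry f)) (T-suc n) ⟩
  ∑ (map (0 ,_) (upTo (suc n)) ++ map (map₁ suc) (T n)) (uncurry f)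
    ≡⟨ ∑-++ (map (0 ,_) (upTo (suc n))) (map (map₁ suc) (T n)) (uncurry f) ⟩
  ∑ (map (0 ,_) (upTo (suc n))) (uncurry f) + ∑ (map (map₁ suc) (T n)) (uncurry f)
    ≡⟨ cong₂ _+_ (∑-map (0 ,_) (upTo (suc n)) (uncurry f))
                 (∑-map (map₁ suc) (T n) (uncurry f)) ⟩
  ∑[ b ∈ upTo (suc n) ] f 0 b + ∑T n (f ∘ suc) ∎
  where open ≡-Reasoning

∑T-cong : ∀ n {f g} → (∀ a b → a + b < n → f a b ≡ g a b) → ∑T n f ≡ ∑T n g
∑T-cong zero    f≗g = refl
∑T-cong (suc n) {f} {g} f≗g = begin
  ∑T (suc n) f
    ≡⟨ ∑T-suc n f ⟩
  ∑[ b ∈ upTo (suc n) ] f 0 b + ∑T n (f ∘ suc)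
    ≡⟨ cong₂ _+_ (∑-upTo-cong (f≗g 0))
                 (∑T-cong n (λ a b a+b<n → f≗g (suc a) b (s≤s a+b<n))) ⟩
  ∑[ b ∈ upTo (suc n) ] g 0 b + ∑T n (g ∘ suc)
    ≡⟨ sym (∑T-suc n g) ⟩
  ∑T (suc n) g ∎
  where open ≡-Reasoning

∑T-one : ∀ n → ∑T n (λ _ _ → 1) ≡ tri n
∑T-one zero    = refl
∑T-one (suc n) = trans (∑T-suc n (λ _ _ → 1))
  (cong₂ _+_ (trans (∑-one (upTo (suc n))) (length-upTo (suc n))) (∑T-one n))

length-T : ∀ n → length (T n) ≡ tri n
length-T n = trans (sym (∑-one (T n))) (∑T-one n)

∑T-point : ∀ n x y → ∑T n (λ e f → 𝟙 (e ≟ x) * 𝟙 (f ≟ y)) ≡ 𝟙 (x + y <? n)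
∑T-point zero    x       y = refl
∑T-point (suc n) zero    y = begin
  ∑T (suc n) (λ e f → 𝟙 (e ≟ 0) * 𝟙 (f ≟ y))
    ≡⟨ ∑T-suc n (λ e f → 𝟙 (e ≟ 0) * 𝟙 (f ≟ y)) ⟩
  ∑[ f ∈ upTo (suc n) ] (1 * 𝟙 (f ≟ y)) + ∑T n (λ _ _ → 0)
    ≡⟨ cong₂ _+_ (∑-cong (λ f → *-identityˡ (𝟙 (f ≟ y))) (upTo (suc n))) (∑-const 0 (T n)) ⟩
  ∑[ f ∈ upTo (suc n) ] 𝟙 (f ≟ y) + 0
    ≡⟨ +-identityʳ _ ⟩
  ∑[ f ∈ upTo (suc n) ] 𝟙 (f ≟ y)
    ≡⟨ ∑-upTo-≟ (suc n) y ⟩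
  𝟙 (y <? suc n) ∎
  where open ≡-Reasoning
∑T-point (suc n) (suc x) y = trans (∑T-suc n (λ e f → 𝟙 (e ≟ suc x) * 𝟙 (f ≟ y)))
  (cong₂ _+_ (∑-const 0 (upTo (suc n))) (∑T-point n x y))

∑T-below : ∀ n k → ∑T n (λ c d → 𝟙 (c + d <? k)) ≡ tri (n ⊓ k)
∑T-below zero    k       = refl
∑T-below (suc n) zero    = trans (∑T-suc n (λ c d → 𝟙 (c + d <? 0)))
  (cong₂ _+_ (∑-upTo-< (suc n) 0) (∑-const 0 (T n)))
∑T-below (suc n) (suc k) = trans (∑T-suc n (λ c d → 𝟙 (c + d <? suc k)))
  (cong₂ _+_ (∑-upTo-< (suc n) (suc k)) (∑T-below n k))

tri-∸ : ∀ n m → (n ∸ m) + tri (n ∸ suc m) ≡ tri (n ∸ m)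
tri-∸ zero    m       rewrite 0∸n≡0 m = refl
tri-∸ (suc n) zero    = refl
tri-∸ (suc n) (suc m) = tri-∸ n m

∑T-above : ∀ n m → ∑T n (λ _ d → 𝟙 (m <? d)) ≡ tri (n ∸ suc m)
∑T-above zero    m = refl
∑T-above (suc n) m = begin
  ∑T (suc n) (λ _ d → 𝟙 (m <? d))
    ≡⟨ ∑T-suc n (λ _ d → 𝟙 (m <? d)) ⟩
  ∑[ d ∈ upTo (suc n) ] 𝟙 (m <? d) + ∑T n (λ _ d → 𝟙 (m <? d))
    ≡⟨ cong₂ _+_ (∑-upTo-> (suc n) m) (∑T-above n m) ⟩
  (n ∸ m) + tri (n ∸ suc m)
    ≡⟨ tri-∸ n m ⟩
  tri (n ∸ m) ∎
  where open ≡-Reasoning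

∑T-right-of : ∀ n k → ∑T n (λ c _ → 𝟙 (k ≤? c)) ≡ tri (n ∸ k)
∑T-right-of zero    k       = cong tri (sym (0∸n≡0 k))
∑T-right-of (suc n) zero    = trans (∑T-suc n (λ c _ → 𝟙 (0 ≤? c)))
  (cong₂ _+_ (trans (∑-one (upTo (suc n))) (length-upTo (suc n))) (∑T-right-of n 0))
∑T-right-of (suc n) (suc k) = begin
  ∑T (suc n) (λ c _ → 𝟙 (suc k ≤? c))
    ≡⟨ ∑T-suc n (λ c _ → 𝟙 (suc k ≤? c)) ⟩
  ∑[ _ ∈ upTo (suc n) ] 0 + ∑T n (λ c _ → 𝟙 (suc k ≤? suc c))
    ≡⟨ cong₂ _+_ (∑-const 0 (upTo (suc n)))
                 (∑-cong (λ (c , _) → 𝟙-cong (suc k ≤? suc c) (k ≤? c) (mk⇔ s≤s⁻¹ s≤s)) (T n)) ⟩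
  ∑T n (λ c _ → 𝟙 (k ≤? c))
    ≡⟨ ∑T-right-of n k ⟩
  tri (n ∸ k) ∎
  where open ≡-Reasoning

∑-upTo-tri : ∀ n → ∑[ b ∈ upTo (suc n) ] tri b ≡ tet n
∑-upTo-tri zero    = refl
∑-upTo-tri (suc n) = begin
  ∑ (upTo (suc (suc n))) tri          ≡⟨ ∑-upTo-∷ʳ (suc n) tri ⟩
  ∑ (upTo (suc n)) tri + tri (suc n)  ≡⟨ cong (_+ tri (suc n)) (∑-upTo-tri n) ⟩
  tet n + tri (suc n)                 ≡⟨ +-comm (tet n) (tri (suc n)) ⟩
  tet (suc n)                         ∎
  where open ≡-Reasoning

∑-upTo-tri-reversed : ∀ n → ∑[ b ∈ upTo (suc n) ] tri (n ∸ b) ≡ tet n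
∑-upTo-tri-reversed zero    = refl
∑-upTo-tri-reversed (suc n) = trans (∑-upTo-suc (suc n) (λ b → tri (suc n ∸ b)))
  (cong (tri (suc n) +_) (∑-upTo-tri-reversed n))

∑T-suc-first : ∀ n → ∑T n (λ a _ → suc a) ≡ tet n
∑T-suc-first zero    = refl
∑T-suc-first (suc n) = begin
  ∑T (suc n) (λ a _ → suc a)
    ≡⟨ ∑T-suc n (λ a _ → suc a) ⟩
  ∑[ _ ∈ upTo (suc n) ] 1 + ∑T n (λ a _ → 1 + suc a)
    ≡⟨ cong₂ _+_ (trans (∑-one (upTo (suc n))) (length-upTo (suc n)))
                 (∑-+ (λ _ → 1) (uncurry (λ a _ → suc a)) (T n)) ⟩
  suc n + (∑T n (λ _ _ → 1) + ∑T n (λ a _ → suc a))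
    ≡⟨ cong₂ (λ x y → suc n + (x + y)) (∑T-one n) (∑T-suc-first n) ⟩
  suc n + (tri n + tet n)
    ≡⟨ sym (+-assoc (suc n) (tri n) (tet n)) ⟩
  tet (suc n) ∎
  where open ≡-Reasoning

-- Sizes of the three corners of T n that hold the q whose apex with p = (a , b) leaves T n.
corners : ℕ → ℕ → ℕ → ℕ
corners n a b = tri a + tri b + tri (n ∸ suc (a + b))

∑T-corners-suc : ∀ n → ∑T (suc n) (corners (suc n)) ≡ 3 * tet n + ∑T n (corners n)
∑T-corners-suc n = begin
  ∑T (suc n) (corners (suc n))
    ≡⟨ ∑T-suc n (corners (suc n)) ⟩
  ∑[ b ∈ upTo (suc n) ] (tri b + tri (n ∸ b))
    + ∑T n (λ a b → suc a + tri a + tri b + tri (n ∸ suc (a + b)))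
    ≡⟨ cong₂ _+_ (∑-+ tri (λ b → tri (n ∸ b)) (upTo (suc n)))
                 (∑-cong (λ (a , b) → reassociate (suc a) (tri a) (tri b) _) (T n)) ⟩
  ∑[ b ∈ upTo (suc n) ] tri b + ∑[ b ∈ upTo (suc n) ] tri (n ∸ b)
    + ∑T n (λ a b → suc a + corners n a b)
    ≡⟨ cong₂ _+_ (cong₂ _+_ (∑-upTo-tri n) (∑-upTo-tri-reversed n))
                 (∑-+ (uncurry (λ a _ → suc a)) (uncurry (corners n)) (T n)) ⟩
  tet n + tet n + (∑T n (λ a _ → suc a) + ∑T n (corners n))
    ≡⟨ cong (λ x → tet n + tet n + (x + ∑T n (corners n))) (∑T-suc-first n) ⟩
  tet n + tet n + (tet n + ∑T n (corners n))
    ≡⟨ collect (tet n) (∑T n (corners n)) ⟩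
  3 * tet n + ∑T n (corners n) ∎
  where
  open ≡-Reasoning
  reassociate : ∀ s x y z → s + x + y + z ≡ s + (x + y + z)
  reassociate = solve-∀
  collect : ∀ t c → t + t + (t + c) ≡ 3 * t + c
  collect = solve-∀

tri-double : ∀ n → 2 * tri n ≡ n * suc n
tri-double zero    = refl
tri-double (suc n) = begin
  2 * (suc n + tri n)     ≡⟨ *-distribˡ-+ 2 (suc n) (tri n) ⟩
  2 * suc n + 2 * tri n   ≡⟨ cong (2 * suc n +_) (tri-double n) ⟩
  2 * suc n + n * suc n   ≡⟨ solve (n ∷ []) ⟩
  suc n * suc (suc n)     ∎
  where open ≡-Reasoning

tet-sextuple : ∀ n → 6 * tet n ≡ n * suc n * suc (suc n)
tet-sextuple zero    = refl
tet-sextuple (suc n) = begin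
  6 * (tri (suc n) + tet n)
    ≡⟨ *-distribˡ-+ 6 (tri (suc n)) (tet n) ⟩
  6 * tri (suc n) + 6 * tet n
    ≡⟨ cong₂ _+_ (trans (*-assoc 3 2 (tri (suc n))) (cong (3 *_) (tri-double (suc n))))
                 (tet-sextuple n) ⟩
  3 * (suc n * suc (suc n)) + n * suc n * suc (suc n)
    ≡⟨ solve (n ∷ []) ⟩
  suc n * suc (suc n) * suc (suc (suc n)) ∎
  where open ≡-Reasoning

∑T-corners : ∀ n → 2 * ∑T n (corners n) + tri n ≡ tri n * tri n
∑T-corners zero    = refl
∑T-corners (suc n) = begin
  2 * ∑T (suc n) (corners (suc n)) + tri (suc n)
    ≡⟨ cong (λ s → 2 * s + tri (suc n)) (∑T-corners-suc n) ⟩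
  2 * (3 * tet n + ∑T n (corners n)) + (suc n + tri n)
    ≡⟨ step n (tri n) (tet n) (∑T n (corners n)) (tri-double n) (tet-sextuple n) (∑T-corners n) ⟩
  (suc n + tri n) * (suc n + tri n) ∎
  where
  open ≡-Reasoning
  step : ∀ n t e c → 2 * t ≡ n * suc n → 6 * e ≡ n * suc n * suc (suc n) → 2 * c + t ≡ t * t →
         2 * (3 * e + c) + (suc n + t) ≡ (suc n + t) * (suc n + t)
  step n t e c 2t≡ 6e≡ 2c+t≡ = begin
    2 * (3 * e + c) + (suc n + t)
      ≡⟨ solve (n ∷ t ∷ e ∷ c ∷ []) ⟩
    6 * e + suc n + (2 * c + t)
      ≡⟨ cong₂ (λ x y → x + suc n + y) 6e≡ 2c+t≡ ⟩
    n * suc n * suc (suc n) + suc n + t * t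
      ≡⟨ solve (n ∷ t ∷ []) ⟩
    suc n * suc n + suc n * (n * suc n) + t * t
      ≡⟨ cong (λ x → suc n * suc n + suc n * x + t * t) (sym 2t≡) ⟩
    suc n * suc n + suc n * (2 * t) + t * t
      ≡⟨ solve (n ∷ t ∷ []) ⟩
    (suc n + t) * (suc n + t) ∎

-- Counting apexes

-- The apex of p = (a , b), q = (c , d) is (a + b ∸ d , c + d ∸ a); the first two conditions
-- say that its coordinates are natural numbers, and its coordinate sum is then b + c.
ApexInside : ℕ → Point → Point → Set
ApexInside n (a , b) (c , d) = d ≤ a + b × a ≤ c + d × b + c < n

apexInside? : ∀ n p q → Dec (ApexInside n p q)
apexInside? n (a , b) (c , d) = d ≤? a + b ×-dec a ≤? c + d ×-dec b + c <? n

+≡⇔≡∸ : ∀ {m n k} → n ≤ k → (m + n ≡ k) ⇔ (m ≡ k ∸ n)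
+≡⇔≡∸ {m} {n} n≤k = mk⇔ (λ m+n≡k → trans (sym (m+n∸n≡m m n)) (cong (_∸ n) m+n≡k))
                         (λ m≡k∸n → trans (cong (_+ n) m≡k∸n) (m∸n+n≡m n≤k))

apex-coordinate-sum : ∀ {a b c d} → d ≤ a + b → a ≤ c + d → (a + b ∸ d) + (c + d ∸ a) ≡ b + c
apex-coordinate-sum {a} {b} {c} {d} d≤a+b a≤c+d = +-cancelʳ-≡ (d + a) _ _ (begin
  (a + b ∸ d) + (c + d ∸ a) + (d + a)  ≡⟨ interchange (a + b ∸ d) (c + d ∸ a) d a ⟩
  (a + b ∸ d + d) + (c + d ∸ a + a)    ≡⟨ cong₂ _+_ (m∸n+n≡m d≤a+b) (m∸n+n≡m a≤c+d) ⟩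
  a + b + (c + d)                      ≡⟨ solve (a ∷ b ∷ c ∷ d ∷ []) ⟩
  b + c + (d + a)                      ∎)
  where open ≡-Reasoning

apexCount≡𝟙 : ∀ n p q → ∑[ r ∈ T n ] 𝟙 (isApex? p q r) ≡ 𝟙 (apexInside? n p q)
apexCount≡𝟙 n (a , b) (c , d) = count (d ≤? a + b) (a ≤? c + d)
  where
  open ≡-Reasoning
  count : (A? : Dec (d ≤ a + b)) (B? : Dec (a ≤ c + d)) →
          ∑[ r ∈ T n ] 𝟙 (isApex? (a , b) (c , d) r) ≡ 𝟙 (A? ×-dec B? ×-dec b + c <? n)
  count (no d≰a+b) _ = trans
    (∑-cong (λ (e , f) → 𝟙-no (isApex? (a , b) (c , d) (e , f))
                              (λ (e+d≡a+b , _) → d≰a+b (subst (d ≤_) e+d≡a+b (m≤n+m d e))))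
            (T n))
    (∑-const 0 (T n))
  count (yes _) (no a≰c+d) = trans
    (∑-cong (λ (e , f) → 𝟙-no (isApex? (a , b) (c , d) (e , f))
                              (λ (_ , f+a≡c+d) → a≰c+d (subst (a ≤_) f+a≡c+d (m≤n+m a f))))
            (T n))
    (∑-const 0 (T n))
  count (yes d≤a+b) (yes a≤c+d) = begin
    ∑[ r ∈ T n ] 𝟙 (isApex? (a , b) (c , d) r)
      ≡⟨ ∑-cong (λ (e , f) → trans (𝟙-× (e + d ≟ a + b) (f + a ≟ c + d)) (cong₂ _*_
                   (𝟙-cong (e + d ≟ a + b) (e ≟ a + b ∸ d) (+≡⇔≡∸ d≤a+b))
                   (𝟙-cong (f + a ≟ c + d) (f ≟ c + d ∸ a) (+≡⇔≡∸ a≤c+d))))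
                (T n) ⟩
    ∑T n (λ e f → 𝟙 (e ≟ a + b ∸ d) * 𝟙 (f ≟ c + d ∸ a))
      ≡⟨ ∑T-point n (a + b ∸ d) (c + d ∸ a) ⟩
    𝟙 ((a + b ∸ d) + (c + d ∸ a) <? n)
      ≡⟨ cong (λ s → 𝟙 (s <? n)) (apex-coordinate-sum d≤a+b a≤c+d) ⟩
    𝟙 (b + c <? n) ∎

-- The last three summands are the negated conditions of ApexInside, at most one of which
-- fails when p, q ∈ T n.
corner-partition : ∀ {n a b c d} → a + b < n → c + d < n →
  𝟙 (apexInside? n (a , b) (c , d)) + 𝟙 (a + b <? d) + 𝟙 (c + d <? a) + 𝟙 (n ≤? b + c) ≡ 1
corner-partition {n} {a} {b} {c} {d} a+b<n c+d<n = begin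
  𝟙 (apexInside? n (a , b) (c , d)) + 𝟙 (a + b <? d) + 𝟙 (c + d <? a) + 𝟙 (n ≤? b + c)
    ≡⟨ sym (cong₂ _+_ (cong₂ (λ x y → 𝟙 (apexInside? n (a , b) (c , d)) + x + y)
                              (𝟙-≰ d (a + b)) (𝟙-≰ a (c + d)))
                      (𝟙-≮ (b + c) n)) ⟩
  𝟙 (apexInside? n (a , b) (c , d))
    + 𝟙 (¬? (d ≤? a + b)) + 𝟙 (¬? (a ≤? c + d)) + 𝟙 (¬? (b + c <? n))
    ≡⟨ 𝟙-partition (d ≤? a + b) (a ≤? c + d) (b + c <? n)
                   (λ d≰a+b → a≤c+d d≰a+b , b+c<n d≰a+b) b+c<n′ ⟩
  1 ∎
  where
  open ≡-Reasoning
  a≤c+d : ¬ d ≤ a + b → a ≤ c + d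
  a≤c+d d≰a+b = ≤-trans (m≤m+n a b) (≤-trans (<⇒≤ (≰⇒> d≰a+b)) (m≤n+m d c))
  b+c<n : ¬ d ≤ a + b → b + c < n
  b+c<n d≰a+b = <-trans (subst (b + c <_) (+-comm d c)
                                (+-monoˡ-< c (≤-<-trans (m≤n+m b a) (≰⇒> d≰a+b))))
                        c+d<n
  b+c<n′ : ¬ a ≤ c + d → b + c < n
  b+c<n′ a≰c+d = <-trans (subst (b + c <_) (+-comm b a)
                                 (+-monoʳ-< b (≤-<-trans (m≤m+n c d) (≰⇒> a≰c+d))))
                         a+b<n

apexes+corners : ∀ {n a b} → a + b < n →
  ∑T n (λ c d → 𝟙 (apexInside? n (a , b) (c , d))) + corners n a b ≡ tri n
apexes+corners {n} {a} {b} a+b<n = begin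
  I + (tri a + tri b + tri (n ∸ suc (a + b)))
    ≡⟨ cong (I +_) (sym (cong₂ _+_ (cong₂ _+_ corner-a corner-b) (∑T-above n (a + b)))) ⟩
  I + (Rₐ + R_b + R_c)
    ≡⟨ shuffle I Rₐ R_b R_c ⟩
  I + R_c + Rₐ + R_b
    ≡⟨ sym (trans (∑-+ _ _ (T n))
                  (cong (_+ R_b) (trans (∑-+ _ _ (T n)) (cong (_+ Rₐ) (∑-+ _ _ (T n)))))) ⟩
  ∑T n (λ c d → 𝟙 (apexInside? n (a , b) (c , d))
                  + 𝟙 (a + b <? d) + 𝟙 (c + d <? a) + 𝟙 (n ≤? b + c))
    ≡⟨ ∑T-cong n (λ c d c+d<n → corner-partition {n} {a} {b} {c} {d} a+b<n c+d<n) ⟩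
  ∑T n (λ _ _ → 1)
    ≡⟨ ∑T-one n ⟩
  tri n ∎
  where
  open ≡-Reasoning
  I   = ∑T n (λ c d → 𝟙 (apexInside? n (a , b) (c , d)))
  Rₐ  = ∑T n (λ c d → 𝟙 (c + d <? a))
  R_b = ∑T n (λ c _ → 𝟙 (n ≤? b + c))
  R_c = ∑T n (λ _ d → 𝟙 (a + b <? d))
  corner-a : Rₐ ≡ tri a
  corner-a = trans (∑T-below n a) (cong tri (m≥n⇒m⊓n≡n (<⇒≤ (≤-<-trans (m≤m+n a b) a+b<n))))
  corner-b : R_b ≡ tri b
  corner-b = begin
    R_b
      ≡⟨ ∑-cong (λ (c , _) → 𝟙-cong (n ≤? b + c) (n ∸ b ≤? c)
                  (mk⇔ (m≤n+o⇒m∸n≤o n b) (≤-trans (m≤n+m∸n n b) ∘ +-monoʳ-≤ b)))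
                (T n) ⟩
    ∑T n (λ c _ → 𝟙 (n ∸ b ≤? c))
      ≡⟨ ∑T-right-of n (n ∸ b) ⟩
    tri (n ∸ (n ∸ b))
      ≡⟨ cong tri (m∸[m∸n]≡n (<⇒≤ (≤-<-trans (m≤n+m b a) a+b<n))) ⟩
    tri b ∎
  shuffle : ∀ i x y z → i + (x + y + z) ≡ i + z + x + y
  shuffle = solve-∀

apexPairs : ℕ → ℕ
apexPairs n = ∑T n (λ a b → ∑T n (λ c d → 𝟙 (apexInside? n (a , b) (c , d))))

apexPairs+corners : ∀ n → apexPairs n + ∑T n (corners n) ≡ tri n * tri n
apexPairs+corners n = begin
  apexPairs n + ∑T n (corners n)
    ≡⟨ sym (∑-+ _ (uncurry (corners n)) (T n)) ⟩
  ∑T n (λ a b → ∑T n (λ c d → 𝟙 (apexInside? n (a , b) (c , d))) + corners n a b)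
    ≡⟨ ∑T-cong n (λ a b a+b<n → apexes+corners a+b<n) ⟩
  ∑T n (λ _ _ → tri n)
    ≡⟨ trans (∑-const (tri n) (T n)) (cong (tri n *_) (length-T n)) ⟩
  tri n * tri n ∎
  where open ≡-Reasoning

apexPairs-double : ∀ n → 2 * apexPairs n ≡ tri n * tri n + tri n
apexPairs-double n =
  halve (apexPairs n) (∑T n (corners n)) (tri n) (apexPairs+corners n) (∑T-corners n)
  where
  open ≡-Reasoning
  halve : ∀ f c t → f + c ≡ t * t → 2 * c + t ≡ t * t → 2 * f ≡ t * t + t
  halve f c t f+c≡ 2c+t≡ = +-cancelʳ-≡ (2 * c) (2 * f) (t * t + t) (begin
    2 * f + 2 * c        ≡⟨ solve (f ∷ c ∷ []) ⟩
    (f + c) + (f + c)    ≡⟨ cong₂ _+_ f+c≡ f+c≡ ⟩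
    t * t + t * t        ≡⟨ cong (t * t +_) (sym 2c+t≡) ⟩
    t * t + (2 * c + t)  ≡⟨ solve (t ∷ c ∷ []) ⟩
    t * t + t + 2 * c    ∎)

properApex : ℕ → Point → Point → ℕ
properApex n p q = 𝟙 (¬? (p ≟P q)) * 𝟙 (apexInside? n p q)

properApex≤1 : ∀ n p q → properApex n p q ≤ 1
properApex≤1 n p q = *-mono-≤ (𝟙≤1 (¬? (p ≟P q))) (𝟙≤1 (apexInside? n p q))

𝟙-equilateral : ∀ p q r → 𝟙 (equilateral? p q r) ≡
                𝟙 (¬? (p ≟P q)) * 𝟙 (isApex? p q r) + 𝟙 (¬? (q ≟P p)) * 𝟙 (isApex? q p r)
𝟙-equilateral p q r = by-cases (p ≟P q)
  where
  open ≡-Reasoning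
  by-cases : (p≟q : Dec (p ≡ q)) → 𝟙 (equilateral? p q r) ≡
             𝟙 (¬? p≟q) * 𝟙 (isApex? p q r) + 𝟙 (¬? (q ≟P p)) * 𝟙 (isApex? q p r)
  by-cases (yes p≡q) = trans
    (𝟙-no (equilateral? p q r) (λ (p≢q , _) → p≢q p≡q))
    (sym (cong (_* 𝟙 (isApex? q p r)) (𝟙-no (¬? (q ≟P p)) (λ q≢p → q≢p (sym p≡q)))))
  by-cases (no p≢q) = begin
    𝟙 (equilateral? p q r)
      ≡⟨ 𝟙-⊎ (equilateral? p q r) (isApex? p q r) (isApex? q p r)
             (λ pqr qpr → p≢q (IsApex-both⇒≡ pqr qpr)) (equilateral⇔apex p≢q) ⟩
    𝟙 (isApex? p q r) + 𝟙 (isApex? q p r)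
      ≡⟨ sym (cong₂ _+_ (*-identityˡ (𝟙 (isApex? p q r)))
                        (trans (cong (_* 𝟙 (isApex? q p r)) (𝟙-yes (¬? (q ≟P p)) (p≢q ∘ sym)))
                               (*-identityˡ (𝟙 (isApex? q p r))))) ⟩
    1 * 𝟙 (isApex? p q r) + 𝟙 (¬? (q ≟P p)) * 𝟙 (isApex? q p r) ∎

thirdCount-split : ∀ n p q → thirdCount n (p , q) ≡ properApex n p q + properApex n q p
thirdCount-split n p q = begin
  length (filter (equilateral? p q) (T n))
    ≡⟨ length-filter (equilateral? p q) (T n) ⟩
  ∑[ r ∈ T n ] 𝟙 (equilateral? p q r)
    ≡⟨ ∑-cong (𝟙-equilateral p q) (T n) ⟩
  ∑[ r ∈ T n ] ([p≢q] * 𝟙 (isApex? p q r) + [q≢p] * 𝟙 (isApex? q p r))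
    ≡⟨ ∑-+ _ _ (T n) ⟩
  ∑[ r ∈ T n ] ([p≢q] * 𝟙 (isApex? p q r)) + ∑[ r ∈ T n ] ([q≢p] * 𝟙 (isApex? q p r))
    ≡⟨ cong₂ _+_ (∑-*ˡ [p≢q] (λ r → 𝟙 (isApex? p q r)) (T n))
                 (∑-*ˡ [q≢p] (λ r → 𝟙 (isApex? q p r)) (T n)) ⟩
  [p≢q] * ∑[ r ∈ T n ] 𝟙 (isApex? p q r) + [q≢p] * ∑[ r ∈ T n ] 𝟙 (isApex? q p r)
    ≡⟨ cong₂ _+_ (cong ([p≢q] *_) (apexCount≡𝟙 n p q)) (cong ([q≢p] *_) (apexCount≡𝟙 n q p)) ⟩
  properApex n p q + properApex n q p ∎
  where
  open ≡-Reasoning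
  [p≢q] = 𝟙 (¬? (p ≟P q))
  [q≢p] = 𝟙 (¬? (q ≟P p))

thirdCount≤2 : ∀ n pq → thirdCount n pq ≤ 2
thirdCount≤2 n (p , q) = subst (_≤ 2) (sym (thirdCount-split n p q))
                               (+-mono-≤ (properApex≤1 n p q) (properApex≤1 n q p))

∑thirdCount≡∑∑properApex : ∀ n →
  ∑ (pairs (T n)) (thirdCount n) ≡ ∑[ p ∈ T n ] ∑[ q ∈ T n ] properApex n p q
∑thirdCount≡∑∑properApex n = begin
  ∑ (pairs (T n)) (thirdCount n)
    ≡⟨ ∑-cong (λ (p , q) → thirdCount-split n p q) (pairs (T n)) ⟩
  Off
    ≡⟨ sym (+-identityʳ Off) ⟩
  Off + 0
    ≡⟨ cong (Off +_) (sym (trans (∑-cong diagonal-zero (T n)) (∑-const 0 (T n)))) ⟩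
  Off + ∑[ p ∈ T n ] properApex n p p
    ≡⟨ ∑-pairs (properApex n) (T n) ⟩
  ∑[ p ∈ T n ] ∑[ q ∈ T n ] properApex n p q ∎
  where
  open ≡-Reasoning
  Off = ∑ (pairs (T n)) (λ (p , q) → properApex n p q + properApex n q p)
  diagonal-zero : ∀ p → properApex n p p ≡ 0
  diagonal-zero p = cong (_* 𝟙 (apexInside? n p p)) (𝟙-no (¬? (p ≟P p)) (λ p≢p → p≢p refl))

diagonal-count : ∀ {n a b} → a + b < n →
  ∑[ q ∈ T n ] (𝟙 ((a , b) ≟P q) * 𝟙 (apexInside? n (a , b) q)) ≡ 1
diagonal-count {n} {a} {b} a+b<n = begin
  ∑[ q ∈ T n ] (𝟙 ((a , b) ≟P q) * 𝟙 (apexInside? n (a , b) q))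
    ≡⟨ ∑-cong (λ (c , d) → point c d ((a , b) ≟P (c , d))) (T n) ⟩
  ∑T n (λ c d → 𝟙 (c ≟ a) * 𝟙 (d ≟ b))
    ≡⟨ ∑T-point n a b ⟩
  𝟙 (a + b <? n)
    ≡⟨ 𝟙-yes (a + b <? n) a+b<n ⟩
  1 ∎
  where
  open ≡-Reasoning
  apexInside-p-p : 𝟙 (apexInside? n (a , b) (a , b)) ≡ 1
  apexInside-p-p = 𝟙-yes (apexInside? n (a , b) (a , b))
                      (m≤n+m b a , m≤m+n a b , subst (_< n) (+-comm a b) a+b<n)
  point : ∀ c d (p≟q : Dec ((a , b) ≡ (c , d))) →
          𝟙 p≟q * 𝟙 (apexInside? n (a , b) (c , d)) ≡ 𝟙 (c ≟ a) * 𝟙 (d ≟ b)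
  point .a .b (yes refl) = begin
    1 * 𝟙 (apexInside? n (a , b) (a , b))
      ≡⟨ *-identityˡ _ ⟩
    𝟙 (apexInside? n (a , b) (a , b))
      ≡⟨ apexInside-p-p ⟩
    1
      ≡⟨ sym (cong₂ _*_ (𝟙-yes (a ≟ a) refl) (𝟙-yes (b ≟ b) refl)) ⟩
    𝟙 (a ≟ a) * 𝟙 (b ≟ b) ∎
  point c d (no p≢q) = sym (trans (sym (𝟙-× (c ≟ a) (d ≟ b)))
    (𝟙-no (c ≟ a ×-dec d ≟ b) (λ (c≡a , d≡b) → p≢q (sym (cong₂ _,_ c≡a d≡b)))))

∑∑properApex+tri≡apexPairs : ∀ n →
  ∑[ p ∈ T n ] ∑[ q ∈ T n ] properApex n p q + tri n ≡ apexPairs n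
∑∑properApex+tri≡apexPairs n = begin
  ∑[ p ∈ T n ] Proper p + tri n
    ≡⟨ cong (∑[ p ∈ T n ] Proper p +_) (sym (∑T-one n)) ⟩
  ∑[ p ∈ T n ] Proper p + ∑T n (λ _ _ → 1)
    ≡⟨ sym (∑-+ Proper (λ _ → 1) (T n)) ⟩
  ∑[ p ∈ T n ] (Proper p + 1)
    ≡⟨ ∑T-cong n (λ a b a+b<n → cong (Proper (a , b) +_) (sym (diagonal-count {n} {a} {b} a+b<n))) ⟩
  ∑[ p ∈ T n ] (Proper p + ∑[ q ∈ T n ] (𝟙 (p ≟P q) * 𝟙 (apexInside? n p q)))
    ≡⟨ ∑-cong (λ p → sym (∑-+ (properApex n p) (λ q → 𝟙 (p ≟P q) * 𝟙 (apexInside? n p q))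
                              (T n)))
              (T n) ⟩
  ∑[ p ∈ T n ] ∑[ q ∈ T n ] (properApex n p q + 𝟙 (p ≟P q) * 𝟙 (apexInside? n p q))
    ≡⟨ ∑-cong (λ p → ∑-cong (λ q → split (p ≟P q) (apexInside? n p q)) (T n)) (T n) ⟩
  apexPairs n ∎
  where
  open ≡-Reasoning
  Proper : Point → ℕ
  Proper p = ∑[ q ∈ T n ] properApex n p q
  split : ∀ {P Q} (P? : Dec P) (Q? : Dec Q) → 𝟙 (¬? P?) * 𝟙 Q? + 𝟙 P? * 𝟙 Q? ≡ 𝟙 Q?
  split P? Q? = trans (sym (*-distribʳ-+ (𝟙 Q?) (𝟙 (¬? P?)) (𝟙 P?)))
                      (trans (cong (_* 𝟙 Q?) (𝟙-¬ P?)) (*-identityˡ (𝟙 Q?)))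

∑thirdCount≡#pairs : ∀ n → ∑ (pairs (T n)) (thirdCount n) ≡ length (pairs (T n))
∑thirdCount≡#pairs n = *-cancelˡ-≡ S L 2 (+-cancelʳ-≡ (2 * N) (2 * S) (2 * L) (begin
  2 * S + 2 * N
    ≡⟨ sym (*-distribˡ-+ 2 S N) ⟩
  2 * (S + N)
    ≡⟨ cong (λ s → 2 * (s + N)) (∑thirdCount≡∑∑properApex n) ⟩
  2 * (∑[ p ∈ T n ] ∑[ q ∈ T n ] properApex n p q + N)
    ≡⟨ cong (2 *_) (∑∑properApex+tri≡apexPairs n) ⟩
  2 * apexPairs n
    ≡⟨ apexPairs-double n ⟩
  N * N + N
    ≡⟨ cong (_+ N) (sym (subst (λ m → 2 * L + m ≡ m * m) (length-T n) (length-pairs (T n)))) ⟩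
  2 * L + N + N
    ≡⟨ +-assoc (2 * L) N N ⟩
  2 * L + (N + N)
    ≡⟨ cong (λ m → 2 * L + (N + m)) (sym (+-identityʳ N)) ⟩
  2 * L + 2 * N ∎))
  where
  open ≡-Reasoning
  S = ∑ (pairs (T n)) (thirdCount n)
  L = length (pairs (T n))
  N = tri n

mainTheorem9 : (n : ℕ) → 1 ≤ n → a 0 n ≡ a 2 n
mainTheorem9 n _ =
  #zeros≡#twos (thirdCount n) (pairs (T n)) (thirdCount≤2 n) (∑thirdCount≡#pairs n)
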